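{- Let $\mathcal{A}$ be an S-ring over a finite abelian group $G$. Suppose that $\mathcal{A}$ is the nontrivial $S$-wreath product for some $\mathcal{A}$-section $S=U/L$, and $L_1$ is an $\mathcal{A}$-subgroup containing $L$. Then $\mathcal{B}=V(K,G)$, where $K=\mathrm{Aut}(\mathcal{A})_{G/L_1}G_{r}$, is also the $S$-wreath product.
   Context: For a finite group $G$ with identity $e$ and $X\subseteq G$ let $\underline{X}=\sum_{x\in X}x\in\mathbb{Z}G$. An S-ring over $G$ is a subring $\mathcal{A}\subseteq\mathbb{Z}G$ for which there is a partition $\mathcal{S}(\mathcal{A})$ of $G$ (basic sets) with $\{e\}\in\mathcal{S}(\mathcal{A})$, closed under $X\mapsto X^{ -1}$, and $\mathcal{A}=\mathrm{Span}_{\mathbb{Z}}\{\underline{X}:X\in\mathcal{S}(\mathcal{A})\}$. An $\mathcal{A}$-subgroup is a subgroup $H$ with $\underline H\in\mathcal{A}$; an $\mathcal{A}$-section is $U/L$ with $L\trianglelefteq U$ both $\mathcal{A}$-subgroups. For $X\subseteq G$, $\mathrm{rad}(X)=\{g\in G: gX=Xg=X\}$. $\mathcal{A}$ is the $U/L$-wreath product if $L\trianglelefteq G$ and $L\le\mathrm{rad}(X)$ for every basic set $X$ not contained in $U$; it is nontrivial if $L\neq\{e\}$ and $U\neq G$. Put $R(X)=\{(g,xg)\}$; $\mathrm{Aut}(\mathcal{A})$ is the group of permutations $f$ of $G$ with $R(X)^f=R(X)$ for all basic $X$. $G_r$ is the group of right translations; for $G_r\le K\le \mathrm{Sym}(G)$,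 $V(K,G)$ is the S-ring whose basic sets are the orbits of the stabilizer $K_e$. $\mathrm{Aut}(\mathcal{A})_{G/L_1}$ denotes the kernel of the action of $\mathrm{Aut}(\mathcal{A})$ on the $L_1$-cosets. -}

module Defs where

open import Data.Nat using (ℕ; _≟_)
open import Data.Bool using (Bool; true; false; if_then_else_; _∧_)
open import Data.Fin using (Fin)
open import Data.List using (List; map; allFin)
open import Data.Nat.ListAction using (sum)
open import Data.Product using (Σ; ∃; _×_; _,_)
open import Data.Fin.Permutation using (Permutation′; _⟨$⟩ʳ_)
open import Relation.Nullary using (¬_)
open import Relation.Nullary.Decidable using (⌊_⌋)
open import Relation.Binary.PropositionalEquality using (_≡_)
open import Function.Bundles using (_⇔_)

-- A finite abelian group, with carrier Fin n (every finite group is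
-- isomorphic to one of this shape).
record FinAbGroup : Set where
  infixl 7 _∙_
  field
    n       : ℕ
    _∙_     : Fin n → Fin n → Fin n
    e       : Fin n
    _⁻¹     : Fin n → Fin n
    assoc   : ∀ x y z → (x ∙ y) ∙ z ≡ x ∙ (y ∙ z)
    comm    : ∀ x y → x ∙ y ≡ y ∙ x
    identityˡ : ∀ x → e ∙ x ≡ x
    inverseˡ  : ∀ x → (x ⁻¹) ∙ x ≡ e

module _ (G : FinAbGroup) where
  open FinAbGroup G

  El : Set
  El = Fin n

  count : (El → Bool) → ℕ
  count P = sum (map (λ x → if P x then 1 else 0) (allFin n))

  -- An S-ring over G, given by its partition into basic sets:
  -- the basic sets are the fibres of  cls : G → ℕ.
  -- Conditions: {e} is basic, inverse-closed, and the Z-span of the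
  -- basic quantities is closed under multiplication (the coefficient of z in
  -- X̲·Y̲, namely #{x ∈ X : x⁻¹z ∈ Y}, is constant on each basic set).
  record IsSRing (cls : El → ℕ) : Set where
    field
      e-basic   : ∀ y → cls y ≡ cls e → y ≡ e
      inv-basic : ∀ x y → cls x ≡ cls y → cls (x ⁻¹) ≡ cls (y ⁻¹)
      mult-closed : ∀ a b z z' → cls z ≡ cls z' →
        count (λ x → ⌊ cls x ≟ cls a ⌋ ∧ ⌊ cls ((x ⁻¹) ∙ z) ≟ cls b ⌋)
        ≡ count (λ x → ⌊ cls x ≟ cls a ⌋ ∧ ⌊ cls ((x ⁻¹) ∙ z') ≟ cls b ⌋)

  Subset : Set
  Subset = El → Bool

  record IsSubgroup (H : Subset) : Set where
    field
      has-e   : H e ≡ true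
      has-∙   : ∀ x y → H x ≡ true → H y ≡ true → H (x ∙ y) ≡ true
      has-inv : ∀ x → H x ≡ true → H (x ⁻¹) ≡ true

  -- From here on a partition of G is described by the relation
  -- "Same x y" : y lies in the basic set containing x.
  -- H is a subgroup with H̲ in the span of the basic sets, i.e. H is a union
  -- of basic sets.
  record IsPartSubgroup (Same : El → El → Set) (H : Subset) : Set where
    field
      subgroup : IsSubgroup H
      union    : ∀ x y → Same x y → H x ≡ H y

  -- U/L is a section (L ≤ U; normality is automatic as G is abelian)
  record IsSection (Same : El → El → Set) (U L : Subset) : Set where
    field
      U-sub : IsPartSubgroup Same U
      L-sub : IsPartSubgroup Same L
      L≤U   : ∀ x → L x ≡ true → U x ≡ true

  -- g ∈ rad(X) for X the basic set containing x: gX = X and Xg = X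
  InRad : (Same : El → El → Set) → El → El → Set
  InRad Same x g = ∀ y → (Same x (g ∙ y) ⇔ Same x y) × (Same x (y ∙ g) ⇔ Same x y)

  NotInside : (Same : El → El → Set) → Subset → El → Set
  NotInside Same U x = ∃ λ y → Same x y × U y ≡ false

  record IsWreath (Same : El → El → Set) (U L : Subset) : Set where
    field
      section : IsSection Same U L
      wreath  : ∀ x → NotInside Same U x →
                ∀ l → L l ≡ true → InRad Same x l

  Nontrivial : Subset → Subset → Set
  Nontrivial U L = (∃ λ l → L l ≡ true × ¬ (l ≡ e)) × (∃ λ g → U g ≡ false)

  SameCls : (El → ℕ) → El → El → Set
  SameCls cls x y = cls x ≡ cls y

  -- f ∈ Aut(A): R(X)^f = R(X) for every basic set X, where
  -- (a , b) ∈ R(X) iff b a⁻¹ ∈ X.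
  IsAut : (El → ℕ) → Permutation′ n → Set
  IsAut cls f = ∀ x a b →
    (cls (b ∙ (a ⁻¹)) ≡ cls x) ⇔ (cls ((f ⟨$⟩ʳ b) ∙ ((f ⟨$⟩ʳ a) ⁻¹)) ≡ cls x)

  -- f ∈ Aut(A)_{G/L₁}: f ∈ Aut(A) fixes every L₁-coset
  InKernel : (El → ℕ) → Subset → Permutation′ n → Set
  InKernel cls L₁ f = IsAut cls f × (∀ x → L₁ ((f ⟨$⟩ʳ x) ∙ (x ⁻¹)) ≡ true)

  -- K = Aut(A)_{G/L₁} G_r; the elements of K are  x ↦ f(x)·g  (f in the
  -- kernel, g ∈ G). Basic sets of V(K,G) = orbits of the stabiliser K_e:
  -- y is in the K_e-orbit of x iff some k ∈ K with k(e) = e has k(x) = y.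
  SameV : (El → ℕ) → Subset → El → El → Set
  SameV cls L₁ x y = Σ (Permutation′ n) λ f → InKernel cls L₁ f ×
    ∃ λ g → ((f ⟨$⟩ʳ e) ∙ g ≡ e) × ((f ⟨$⟩ʳ x) ∙ g ≡ y)

module Submission where

-- An element of the stabiliser K_e has the form k(x) = f(x)·f(e)⁻¹ with f ∈ Aut(A)_{G/L₁},
-- so it preserves the basic sets of A and every A-subgroup is a union of basic sets of
-- V(K,G). For the radical condition let y = k(x) lie outside U and l ∈ L. The map σ that
-- multiplies by l every element outside the U-coset of f(e), and fixes that coset, is an
-- automorphism of A: it changes a difference b·a⁻¹ only by a factor l^{±1}, and only when a
-- and b lie in different U-cosets, i.e. when b·a⁻¹ ∉ U, where l is in the radical of the
-- basic set of b·a⁻¹. Since σ moves points by elements of L ≤ L₁, σ∘f is again in the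
-- kernel, and the same right translation takes it to an element of K_e sending x to l·y.

open import Defs
open import Level using (0ℓ)
open import Data.Nat using (ℕ)
open import Data.Bool using (true; false; if_then_else_)
open import Data.Product using (_,_; proj₁)
open import Data.Fin.Permutation using (Permutation′; _⟨$⟩ʳ_; permutation; _∘ₚ_)
open import Relation.Binary.PropositionalEquality
open import Function.Bundles using (_⇔_; mk⇔; Equivalence)
import Function.Properties.Equivalence as ⇔
open import Algebra.Bundles using (AbelianGroup)
import Algebra.Properties.AbelianGroup as AbelianGroupProperties
import Algebra.Properties.CommutativeSemigroup as CommutativeSemigroupProperties

abelianGroup : FinAbGroup → AbelianGroup 0ℓ 0ℓ
abelianGroup G = record
  { Carrier = El G
  ; _≈_ = _≡_
  ; _∙_ = _∙_
  ; ε = e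
  ; _⁻¹ = _⁻¹
  ; isAbelianGroup = record
    { isGroup = record
      { isMonoid = record
        { isSemigroup = record
          { isMagma = record { isEquivalence = isEquivalence ; ∙-cong = cong₂ _∙_ }
          ; assoc = assoc
          }
        ; identity = identityˡ , λ x → trans (comm x e) (identityˡ x)
        }
      ; inverse = inverseˡ , λ x → trans (comm x (x ⁻¹)) (inverseˡ x)
      ; ⁻¹-cong = cong _⁻¹
      }
    ; comm = comm
    }
  }
  where open FinAbGroup G

module _ (G : FinAbGroup) where
  open FinAbGroup G
  open AbelianGroup (abelianGroup G) using (identityʳ; inverseʳ; commutativeSemigroup)
  open AbelianGroupProperties (abelianGroup G)
    using (inverseʳ-unique; ε⁻¹≈ε; ⁻¹-anti-homo‿-; ⁻¹-∙-comm; \\-leftDividesʳ; //-rightDividesʳ)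
  open CommutativeSemigroupProperties commutativeSemigroup
    using (interchange; xy∙z≈y∙xz; xy∙z≈xz∙y; x∙yz≈z∙xy)
  open ≡-Reasoning

  ∙-cancel-middle : ∀ q p d → (q ∙ (p ⁻¹)) ∙ (p ∙ d) ≡ q ∙ d
  ∙-cancel-middle q p d = trans (assoc q (p ⁻¹) (p ∙ d)) (cong (q ∙_) (\\-leftDividesʳ p d))

  difference-translateˡ : ∀ b a l → (b ∙ l) ∙ (a ⁻¹) ≡ l ∙ (b ∙ (a ⁻¹))
  difference-translateˡ b a l = xy∙z≈y∙xz b l (a ⁻¹)

  difference-translateʳ : ∀ b a l → b ∙ ((a ∙ l) ⁻¹) ≡ (l ⁻¹) ∙ (b ∙ (a ⁻¹))
  difference-translateʳ b a l = begin
    b ∙ ((a ∙ l) ⁻¹)         ≡⟨ cong (b ∙_) (sym (⁻¹-∙-comm a l)) ⟩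
    b ∙ ((a ⁻¹) ∙ (l ⁻¹))    ≡⟨ x∙yz≈z∙xy b (a ⁻¹) (l ⁻¹) ⟩
    (l ⁻¹) ∙ (b ∙ (a ⁻¹))    ∎

  difference-translate : ∀ b a l → (b ∙ l) ∙ ((a ∙ l) ⁻¹) ≡ b ∙ (a ⁻¹)
  difference-translate b a l = begin
    (b ∙ l) ∙ ((a ∙ l) ⁻¹)        ≡⟨ cong ((b ∙ l) ∙_) (sym (⁻¹-∙-comm a l)) ⟩
    (b ∙ l) ∙ ((a ⁻¹) ∙ (l ⁻¹))   ≡⟨ interchange b l (a ⁻¹) (l ⁻¹) ⟩
    (b ∙ (a ⁻¹)) ∙ (l ∙ (l ⁻¹))   ≡⟨ cong ((b ∙ (a ⁻¹)) ∙_) (inverseʳ l) ⟩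
    (b ∙ (a ⁻¹)) ∙ e              ≡⟨ identityʳ (b ∙ (a ⁻¹)) ⟩
    b ∙ (a ⁻¹)                    ∎

  data Membership (H : Subset G) (x : El G) : Set where
    member    : H x ≡ true → Membership H x
    nonmember : H x ≡ false → Membership H x

  membership : ∀ H x → Membership H x
  membership H x with H x in Hx
  ... | true  = member Hx
  ... | false = nonmember Hx

  module _ {H : Subset G} (H-subgroup : IsSubgroup G H) where
    open IsSubgroup H-subgroup

    coset-trans : ∀ q p d → H (q ∙ (p ⁻¹)) ≡ true → H (p ∙ d) ≡ true → H (q ∙ d) ≡ true
    coset-trans q p d qp pd =
      subst (λ w → H w ≡ true) (∙-cancel-middle q p d) (has-∙ _ _ qp pd)

    ∉-∙ʳ : ∀ {x l} → H x ≡ false → H l ≡ true → H (x ∙ l) ≡ false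
    ∉-∙ʳ {x} {l} Hx Hl with H (x ∙ l) in xl
    ... | false = refl
    ... | true  = trans (sym (subst (λ w → H w ≡ true) (//-rightDividesʳ l x) (has-∙ _ _ xl (has-inv l Hl)))) Hx

    difference-∉ : ∀ {a b} d → H (a ∙ d) ≡ true → H (b ∙ d) ≡ false → H (b ∙ (a ⁻¹)) ≡ false
    difference-∉ {a} {b} d ad bd with H (b ∙ (a ⁻¹)) in ba
    ... | false = refl
    ... | true  = trans (sym (coset-trans b a d ba ad)) bd

    difference-∉′ : ∀ {a b} d → H (a ∙ d) ≡ false → H (b ∙ d) ≡ true → H (b ∙ (a ⁻¹)) ≡ false
    difference-∉′ {a} {b} d ad bd with H (b ∙ (a ⁻¹)) in ba
    ... | false = refl
    ... | true  = trans (sym (coset-trans a b d ab bd)) ad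
      where
      ab : H (a ∙ (b ⁻¹)) ≡ true
      ab = subst (λ w → H w ≡ true) (⁻¹-anti-homo‿- b a) (has-inv _ ba)

    partialShift : El G → El G → El G → El G
    partialShift d l z = if H (z ∙ d) then z else z ∙ l

    partialShift-inside : ∀ d l z → H (z ∙ d) ≡ true → partialShift d l z ≡ z
    partialShift-inside d l z h rewrite h = refl

    partialShift-outside : ∀ d l z → H (z ∙ d) ≡ false → partialShift d l z ≡ z ∙ l
    partialShift-outside d l z h rewrite h = refl

    partialShift-inverse : ∀ d {l l′} → H l ≡ true → l ∙ l′ ≡ e →
      ∀ z → partialShift d l′ (partialShift d l z) ≡ z
    partialShift-inverse d {l} {l′} Hl ll′ z with membership H (z ∙ d)
    ... | member zd = trans (cong (partialShift d l′) (partialShift-inside d l z zd))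
                            (partialShift-inside d l′ z zd)
    ... | nonmember zd = begin
      partialShift d l′ (partialShift d l z) ≡⟨ cong (partialShift d l′) (partialShift-outside d l z zd) ⟩
      partialShift d l′ (z ∙ l)              ≡⟨ partialShift-outside d l′ (z ∙ l) zld ⟩
      (z ∙ l) ∙ l′                           ≡⟨ assoc z l l′ ⟩
      z ∙ (l ∙ l′)                           ≡⟨ cong (z ∙_) ll′ ⟩
      z ∙ e                                  ≡⟨ identityʳ z ⟩
      z                                      ∎
      where
      zld : H ((z ∙ l) ∙ d) ≡ false
      zld = trans (cong H (xy∙z≈xz∙y z l d)) (∉-∙ʳ zd Hl)

    partialShift↔ : El G → (l : El G) → H l ≡ true → Permutation′ n
    partialShift↔ d l Hl = permutation (partialShift d l) (partialShift d (l ⁻¹))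
      (partialShift-inverse d (has-inv l Hl) (inverseˡ l))
      (partialShift-inverse d Hl (inverseʳ l))

    partialShift-displacement : ∀ {K : Subset G} → IsSubgroup G K →
      ∀ d {l} → K l ≡ true → ∀ z → K (partialShift d l z ∙ (z ⁻¹)) ≡ true
    partialShift-displacement {K} K-subgroup d {l} Kl z with membership H (z ∙ d)
    ... | member zd = subst (λ w → K w ≡ true)
      (sym (trans (cong (_∙ (z ⁻¹)) (partialShift-inside d l z zd)) (inverseʳ z)))
      (IsSubgroup.has-e K-subgroup)
    ... | nonmember zd = subst (λ w → K w ≡ true)
      (sym (trans (cong (_∙ (z ⁻¹)) (trans (partialShift-outside d l z zd) (comm z l))) (//-rightDividesʳ z l)))
      Kl

  IsAut-∘ : ∀ {cls f g} → IsAut G cls f → IsAut G cls g → IsAut G cls (f ∘ₚ g)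
  IsAut-∘ {f = f} f-aut g-aut x a b = ⇔.trans (f-aut x a b) (g-aut x (f ⟨$⟩ʳ a) (f ⟨$⟩ʳ b))

  InKernel-∘ : ∀ {cls L₁ f g} → IsSubgroup G L₁ →
    InKernel G cls L₁ f → InKernel G cls L₁ g → InKernel G cls L₁ (f ∘ₚ g)
  InKernel-∘ {cls} {L₁} {f} {g} L₁-subgroup (f-aut , f-ker) (g-aut , g-ker) =
    IsAut-∘ {cls} {f} {g} f-aut g-aut , λ x →
      coset-trans L₁-subgroup (g ⟨$⟩ʳ (f ⟨$⟩ʳ x)) (f ⟨$⟩ʳ x) (x ⁻¹) (g-ker (f ⟨$⟩ʳ x)) (f-ker x)

  module SameVClasses (cls : El G → ℕ) (L₁ : Subset G) where

    SameV-union : ∀ {H} → IsPartSubgroup G (SameCls G cls) H →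
      ∀ x y → SameV G cls L₁ x y → H x ≡ H y
    SameV-union {H} H-sub x y (f , (f-aut , _) , g , fe , fx) = begin
      H x                            ≡⟨ IsPartSubgroup.union H-sub _ _ f-preserves-x ⟨
      H ((f ⟨$⟩ʳ x) ∙ ((f ⟨$⟩ʳ e) ⁻¹)) ≡⟨ cong (λ w → H ((f ⟨$⟩ʳ x) ∙ w)) (inverseʳ-unique _ _ fe) ⟨
      H ((f ⟨$⟩ʳ x) ∙ g)              ≡⟨ cong H fx ⟩
      H y                            ∎
      where
      f-preserves-x : cls ((f ⟨$⟩ʳ x) ∙ ((f ⟨$⟩ʳ e) ⁻¹)) ≡ cls x
      f-preserves-x = Equivalence.to (f-aut x e x) (cong cls (trans (cong (x ∙_) ε⁻¹≈ε) (identityʳ x)))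

    IsPartSubgroup-SameV : ∀ {H} → IsPartSubgroup G (SameCls G cls) H → IsPartSubgroup G (SameV G cls L₁) H
    IsPartSubgroup-SameV H-sub = record
      { subgroup = IsPartSubgroup.subgroup H-sub ; union = SameV-union H-sub }

  module _ {cls : El G → ℕ} {U L : Subset G} (wr : IsWreath G (SameCls G cls) U L) where
    open IsWreath wr
    open IsSection section
    open IsPartSubgroup U-sub renaming (subgroup to U-subgroup)
    open IsPartSubgroup L-sub renaming (subgroup to L-subgroup)

    wreath-absorbs : ∀ {z} → U z ≡ false → ∀ {l} → L l ≡ true → cls (l ∙ z) ≡ cls z
    wreath-absorbs {z} Uz {l} Ll = sym (Equivalence.from (proj₁ (wreath z (z , refl , Uz) l Ll z)) refl)

    module _ (d : El G) {l : El G} (Ll : L l ≡ true) where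
      private
        m : El G → El G
        m = partialShift U-subgroup d l
        inside : ∀ z → U (z ∙ d) ≡ true → m z ≡ z
        inside = partialShift-inside U-subgroup d l
        outside : ∀ z → U (z ∙ d) ≡ false → m z ≡ z ∙ l
        outside = partialShift-outside U-subgroup d l
        difference : El G → El G → El G
        difference u v = u ∙ (v ⁻¹)

      partialShift-difference : ∀ a b → cls (m b ∙ (m a ⁻¹)) ≡ cls (b ∙ (a ⁻¹))
      partialShift-difference a b with membership U (a ∙ d) | membership U (b ∙ d)
      ... | member ad | member bd = cong cls (cong₂ difference (inside b bd) (inside a ad))
      ... | member ad | nonmember bd = begin
        cls (m b ∙ (m a ⁻¹))     ≡⟨ cong cls (cong₂ difference (outside b bd) (inside a ad)) ⟩
        cls ((b ∙ l) ∙ (a ⁻¹))   ≡⟨ cong cls (difference-translateˡ b a l) ⟩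
        cls (l ∙ (b ∙ (a ⁻¹)))   ≡⟨ wreath-absorbs (difference-∉ U-subgroup d ad bd) Ll ⟩
        cls (b ∙ (a ⁻¹))         ∎
      ... | nonmember ad | member bd = begin
        cls (m b ∙ (m a ⁻¹))        ≡⟨ cong cls (cong₂ difference (inside b bd) (outside a ad)) ⟩
        cls (b ∙ ((a ∙ l) ⁻¹))      ≡⟨ cong cls (difference-translateʳ b a l) ⟩
        cls ((l ⁻¹) ∙ (b ∙ (a ⁻¹))) ≡⟨ wreath-absorbs (difference-∉′ U-subgroup d ad bd) (has-inv l Ll) ⟩
        cls (b ∙ (a ⁻¹))            ∎
        where open IsSubgroup L-subgroup using (has-inv)
      ... | nonmember ad | nonmember bd = begin
        cls (m b ∙ (m a ⁻¹))          ≡⟨ cong cls (cong₂ difference (outside b bd) (outside a ad)) ⟩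
        cls ((b ∙ l) ∙ ((a ∙ l) ⁻¹))  ≡⟨ cong cls (difference-translate b a l) ⟩
        cls (b ∙ (a ⁻¹))              ∎

      partialShift↔-isAut : IsAut G cls (partialShift↔ U-subgroup d l (L≤U l Ll))
      partialShift↔-isAut x a b = mk⇔ (trans (partialShift-difference a b))
                                       (trans (sym (partialShift-difference a b)))

    module _ {L₁ : Subset G} (L₁-subgroup : IsSubgroup G L₁) (L⊆L₁ : ∀ x → L x ≡ true → L₁ x ≡ true) where
      open SameVClasses cls L₁

      SameV-translate : ∀ {x y} → U y ≡ false → ∀ {l} → L l ≡ true →
        SameV G cls L₁ x y → SameV G cls L₁ x (l ∙ y)
      SameV-translate {x} {y} Uy {l} Ll (f , f-ker , g , fe , fx) =
        f ∘ₚ σ , InKernel-∘ {cls} {f = f} {σ} L₁-subgroup f-ker (partialShift↔-isAut g Ll , σ-ker) ,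
        g , σfe , σfx
        where
        σ : Permutation′ n
        σ = partialShift↔ U-subgroup g l (L≤U l Ll)
        σ-ker : ∀ z → L₁ ((σ ⟨$⟩ʳ z) ∙ (z ⁻¹)) ≡ true
        σ-ker = partialShift-displacement U-subgroup L₁-subgroup g (L⊆L₁ l Ll)
        σfe : (σ ⟨$⟩ʳ (f ⟨$⟩ʳ e)) ∙ g ≡ e
        σfe = trans (cong (_∙ g) (partialShift-inside U-subgroup g l _ fe∙g∈U)) fe
          where
          fe∙g∈U : U ((f ⟨$⟩ʳ e) ∙ g) ≡ true
          fe∙g∈U = trans (cong U fe) (IsSubgroup.has-e U-subgroup)
        σfx : (σ ⟨$⟩ʳ (f ⟨$⟩ʳ x)) ∙ g ≡ l ∙ y
        σfx = begin
          (σ ⟨$⟩ʳ (f ⟨$⟩ʳ x)) ∙ g  ≡⟨ cong (_∙ g) (partialShift-outside U-subgroup g l _ (trans (cong U fx) Uy)) ⟩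
          ((f ⟨$⟩ʳ x) ∙ l) ∙ g    ≡⟨ xy∙z≈xz∙y _ l g ⟩
          ((f ⟨$⟩ʳ x) ∙ g) ∙ l    ≡⟨ comm _ l ⟩
          l ∙ ((f ⟨$⟩ʳ x) ∙ g)    ≡⟨ cong (l ∙_) fx ⟩
          l ∙ y                  ∎

      SameV-translate-⇔ : ∀ x → NotInside G (SameV G cls L₁) U x → ∀ {l} → L l ≡ true →
        ∀ y → SameV G cls L₁ x (l ∙ y) ⇔ SameV G cls L₁ x y
      SameV-translate-⇔ x (x′ , xx′ , Ux′) {l} Ll y = mk⇔
        (λ xly → subst (SameV G cls L₁ x) (\\-leftDividesʳ l y)
                   (SameV-translate (∉U _ xly) (IsSubgroup.has-inv L-subgroup l Ll) xly))
        (λ xy → SameV-translate (∉U y xy) Ll xy)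
        where
        ∉U : ∀ z → SameV G cls L₁ x z → U z ≡ false
        ∉U z xz = trans (sym (SameV-union U-sub x z xz)) (trans (SameV-union U-sub x x′ xx′) Ux′)

      SameV-isWreath : IsWreath G (SameV G cls L₁) U L
      SameV-isWreath = record
        { section = record
          { U-sub = IsPartSubgroup-SameV U-sub ; L-sub = IsPartSubgroup-SameV L-sub ; L≤U = L≤U }
        ; wreath = λ x x∉U l Ll y → SameV-translate-⇔ x x∉U Ll y ,
            subst (λ w → SameV G cls L₁ x w ⇔ SameV G cls L₁ x y) (comm l y) (SameV-translate-⇔ x x∉U Ll y)
        }

lemma5p4 : (G : FinAbGroup) (cls : El G → ℕ) → IsSRing G cls →
    (U L L₁ : Subset G) →
    IsWreath G (SameCls G cls) U L → Nontrivial G U L →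
    IsPartSubgroup G (SameCls G cls) L₁ → (∀ x → L x ≡ true → L₁ x ≡ true) →
    IsWreath G (SameV G cls L₁) U L
lemma5p4 G cls _ U L L₁ wr _ L₁-sub L⊆L₁ = SameV-isWreath G wr (IsPartSubgroup.subgroup L₁-sub) L⊆L₁
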